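{- For $r \geq 2$ and $n_1 \geq n_2 \geq \cdots \geq n_r \geq 2$, the complete multipartite graph $K_{n_1,n_2,\dots,n_r}$ satisfies $\mathrm{tp}(K_{n_1,\dots,n_r}) = \mathrm{tp}^-(K_{n_1,\dots,n_r}) = r$.
   Context: $K_{n_1,\dots,n_r}$ is the complete multipartite graph whose vertex set is partitioned into independent sets of sizes $n_1,\dots,n_r$, with two vertices adjacent iff they lie in different parts. A set $S \subseteq V(G)$ is in general position if no shortest path of $G$ contains three vertices of $S$. A terminal set of $G$ is a general position set $S$ that is maximal under inclusion and such that for every $u \in V(G)\setminus S$ there is a shortest path of $G$ with $u$ as an endpoint containing at least two vertices of $S$. $\mathrm{tp}(G)$ and $\mathrm{tp}^-(G)$ are the orders of a largest and a smallest terminal set, respectively. -}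

module Defs where

open import Level using (Level; suc; _⊔_)
open import Data.Nat using (ℕ; _≤_)
open import Data.Fin using (Fin)
open import Data.Product using (Σ; _×_; _,_; ∃; proj₁)
open import Data.Sum using (_⊎_)
open import Data.List using (List; []; _∷_; length)
open import Data.List.Membership.Propositional using (_∈_; _∉_)
open import Data.List.Relation.Unary.Unique.Propositional using (Unique)
open import Relation.Binary.PropositionalEquality using (_≡_)
open import Relation.Nullary using (¬_)

record Graph : Set₁ where
  field
    V   : Set
    _~_ : V → V → Set

module _ (G : Graph) where
  open Graph G

  data Walk : V → V → Set where
    []  : ∀ {u} → Walk u u
    _∷_ : ∀ {u w v} → u ~ w → Walk w v → Walk u v

  len : ∀ {u v} → Walk u v → ℕ
  len []      = 0
  len (_ ∷ p) = Data.Nat.suc (len p)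

  verts : ∀ {u v} → Walk u v → List V
  verts {u} []      = u ∷ []
  verts {u} (_ ∷ p) = u ∷ verts p

  IsShortestPath : ∀ {u v} → Walk u v → Set
  IsShortestPath {u} {v} p = Unique (verts p) × ((q : Walk u v) → len p ≤ len q)

  -- vertex sets are duplicate-free lists of vertices
  _⊆ₗ_ : List V → List V → Set
  S ⊆ₗ T = ∀ {x} → x ∈ S → x ∈ T

  IsGenPos : List V → Set
  IsGenPos S = Unique S ×
    (∀ {u v} (p : Walk u v) → IsShortestPath p →
      ∀ x y z → x ∈ S → y ∈ S → z ∈ S →
        ¬ x ≡ y → ¬ x ≡ z → ¬ y ≡ z →
        ¬ (x ∈ verts p × y ∈ verts p × z ∈ verts p))

  IsMaximalGenPos : List V → Set
  IsMaximalGenPos S = IsGenPos S × (∀ T → IsGenPos T → S ⊆ₗ T → T ⊆ₗ S)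

  IsTerminal : List V → Set
  IsTerminal S = IsMaximalGenPos S ×
    (∀ u → u ∉ S →
      Σ V λ w →
        (Σ (Walk u w) λ p → IsShortestPath p ×
           Σ V λ x → Σ V λ y → x ∈ S × y ∈ S × ¬ x ≡ y × x ∈ verts p × y ∈ verts p)
        ⊎
        (Σ (Walk w u) λ p → IsShortestPath p ×
           Σ V λ x → Σ V λ y → x ∈ S × y ∈ S × ¬ x ≡ y × x ∈ verts p × y ∈ verts p))

  IsTp : ℕ → Set
  IsTp k = (Σ (List V) λ S → IsTerminal S × length S ≡ k)
         × (∀ S → IsTerminal S → length S ≤ k)

  IsTpMinus : ℕ → Set
  IsTpMinus k = (Σ (List V) λ S → IsTerminal S × length S ≡ k)
              × (∀ S → IsTerminal S → k ≤ length S)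

-- complete multipartite graph K_{n_1,...,n_r}: vertex (i , a) is vertex a
-- of part i; adjacent iff in different parts
K : (r : ℕ) → (Fin r → ℕ) → Graph
K r n = record
  { V   = Σ (Fin r) (λ i → Fin (n i))
  ; _~_ = λ x y → ¬ proj₁ x ≡ proj₁ y
  }

{-# OPTIONS --safe #-}
-- Any two vertices of K_{n₁,…,n_r} are at distance at most 2, and a geodesic of length 2 joins
-- two vertices of one part through a vertex of another part. Hence a geodesic meets at most two
-- parts, and at most one of its vertices lies outside the part of either endpoint. The first fact
-- makes every transversal (one vertex from each part) a general position set; the detour u – w – v
-- between two vertices of one part through a vertex of another part makes it maximal and terminal.
-- Conversely, a terminal set S meets every part, since a vertex of a part missed by S would be the
-- endpoint of a geodesic carrying two vertices of S outside its part; a detour through the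
-- S-vertex of another part then forbids two S-vertices in one part. So the terminal sets are
-- exactly the transversals, all of order r.
module Submission where

open import Defs
open import Data.Nat using (ℕ; _≤_; z≤n; s≤s)
open import Data.Nat.Properties using (≤-trans; ≤-refl; ≤-reflexive)
open import Data.Fin using (Fin; zero; suc; fromℕ<; _≟_)
open import Data.Product using (Σ; ∃; _×_; _,_; proj₁; proj₂)
open import Data.Product.Properties using (≡-dec)
open import Data.Sum using (inj₁; inj₂)
open import Data.Empty using (⊥; ⊥-elim)
open import Data.List using (List; []; _∷_; length; tabulate)
open import Data.List.Properties using (length-tabulate)
open import Data.List.Relation.Unary.Any using (here; there; any?)
open import Data.List.Relation.Unary.All using ([]; _∷_)
open import Data.List.Relation.Unary.AllPairs using ([]; _∷_)
open import Data.List.Membership.Propositional using (_∈_; lose; find)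
open import Data.List.Membership.Propositional.Properties using (∈-tabulate⁺; ∈-tabulate⁻)
open import Data.List.Membership.Propositional.Properties.WithK using (unique∧set⇒bag)
open import Data.List.Relation.Unary.Unique.Propositional using (Unique)
open import Data.List.Relation.Unary.Unique.Propositional.Properties using (tabulate⁺)
open import Data.List.Relation.Binary.BagAndSetEquality using (_∼[_]_; set; ∼bag⇒↭)
open import Data.List.Relation.Binary.Permutation.Propositional.Properties using (↭-length)
open import Function using (_∘_)
open import Function.Bundles using (mk⇔)
open import Relation.Binary.PropositionalEquality using (_≡_; _≢_; refl; sym; trans; cong; subst)
open import Relation.Nullary using (yes; no)

unique∧set⇒length≡ : ∀ {A : Set} {xs ys : List A} → Unique xs → Unique ys →
                    xs ∼[ set ] ys → length xs ≡ length ys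
unique∧set⇒length≡ xs! ys! xs≈ys = ↭-length (∼bag⇒↭ (unique∧set⇒bag xs! ys! xs≈ys))

anotherPart : ∀ {r} → 2 ≤ r → (j : Fin r) → ∃ λ k → k ≢ j
anotherPart (s≤s (s≤s z≤n)) zero    = suc zero , λ ()
anotherPart (s≤s (s≤s z≤n)) (suc _) = zero , λ ()

module _ {r : ℕ} {n : Fin r → ℕ} where
  private
    G = K r n
  open Graph G

  part : V → Fin r
  part = proj₁

  walkOfLength≤2 : ∀ {a} w → a ~ w → (b : V) → Σ (Walk G a b) λ q → len G q ≤ 2
  walkOfLength≤2 {a} w a~w b with part a ≟ part b
  ... | no a~b  = (a~b ∷ []) , s≤s z≤n
  ... | yes a≈b = (_∷_ {w = w} a~w ((λ w≈b → a~w (trans a≈b (sym w≈b))) ∷ [])) , ≤-refl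

  shortest-len≤2 : ∀ {a b} (p : Walk G a b) → IsShortestPath G p → len G p ≤ 2
  shortest-len≤2 [] _ = z≤n
  shortest-len≤2 {b = b} (_∷_ {w = w} a~w _) (_ , minimal) =
    let q , q≤2 = walkOfLength≤2 w a~w b in ≤-trans (minimal q) q≤2

  shortest-len2⇒samePart : ∀ {a b} (p : Walk G a b) → IsShortestPath G p → 2 ≤ len G p →
                           part a ≡ part b
  shortest-len2⇒samePart {a} {b} p (_ , minimal) 2≤p with part a ≟ part b
  ... | yes a≈b = a≈b
  ... | no  a~b with ≤-trans 2≤p (minimal (a~b ∷ []))
  ...   | s≤s ()

  outsideStart-unique : ∀ {a b x y} (p : Walk G a b) → IsShortestPath G p →
                        x ∈ verts G p → y ∈ verts G p → part x ≢ part a → part y ≢ part a → x ≡ y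
  outsideStart-unique [] _ (here refl) _ x~a _ = ⊥-elim (x~a refl)
  outsideStart-unique (_ ∷ _) _ (here refl) _ x~a _ = ⊥-elim (x~a refl)
  outsideStart-unique (_ ∷ _) _ _ (here refl) _ y~a = ⊥-elim (y~a refl)
  outsideStart-unique (_ ∷ []) _ (there (here refl)) (there (here refl)) _ _ = refl
  outsideStart-unique (_ ∷ _ ∷ []) _ (there (here refl)) (there (here refl)) _ _ = refl
  outsideStart-unique p@(_ ∷ _ ∷ []) p-sp (there (there (here refl))) _ x~a _ =
    ⊥-elim (x~a (sym (shortest-len2⇒samePart p p-sp ≤-refl)))
  outsideStart-unique p@(_ ∷ _ ∷ []) p-sp _ (there (there (here refl))) _ y~a =
    ⊥-elim (y~a (sym (shortest-len2⇒samePart p p-sp ≤-refl)))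
  outsideStart-unique p@(_ ∷ _ ∷ _ ∷ _) p-sp _ _ _ _ with shortest-len≤2 p p-sp
  ... | s≤s (s≤s ())

  outsideEnd-unique : ∀ {a b x y} (p : Walk G a b) → IsShortestPath G p →
                      x ∈ verts G p → y ∈ verts G p → part x ≢ part b → part y ≢ part b → x ≡ y
  outsideEnd-unique [] _ (here refl) _ x~b _ = ⊥-elim (x~b refl)
  outsideEnd-unique (_ ∷ []) _ (there (here refl)) _ x~b _ = ⊥-elim (x~b refl)
  outsideEnd-unique (_ ∷ []) _ _ (there (here refl)) _ y~b = ⊥-elim (y~b refl)
  outsideEnd-unique (_ ∷ []) _ (here refl) (here refl) _ _ = refl
  outsideEnd-unique (_ ∷ _ ∷ []) _ (there (there (here refl))) _ x~b _ = ⊥-elim (x~b refl)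
  outsideEnd-unique (_ ∷ _ ∷ []) _ _ (there (there (here refl))) _ y~b = ⊥-elim (y~b refl)
  outsideEnd-unique p@(_ ∷ _ ∷ []) p-sp (here refl) _ x~b _ =
    ⊥-elim (x~b (shortest-len2⇒samePart p p-sp ≤-refl))
  outsideEnd-unique p@(_ ∷ _ ∷ []) p-sp _ (here refl) _ y~b =
    ⊥-elim (y~b (shortest-len2⇒samePart p p-sp ≤-refl))
  outsideEnd-unique (_ ∷ _ ∷ []) _ (there (here refl)) (there (here refl)) _ _ = refl
  outsideEnd-unique p@(_ ∷ _ ∷ _ ∷ _) p-sp _ _ _ _ with shortest-len≤2 p p-sp
  ... | s≤s (s≤s ())

  shortest-meetsAtMostTwoParts : ∀ {a b x y z} (p : Walk G a b) → IsShortestPath G p →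
    x ∈ verts G p → y ∈ verts G p → z ∈ verts G p →
    part x ≢ part y → part x ≢ part z → part y ≢ part z → ⊥
  shortest-meetsAtMostTwoParts {a} {x = x} {y} p p-sp x∈p y∈p z∈p x~y x~z y~z
    with part x ≟ part a | part y ≟ part a
  ... | yes x≈a | _       = y~z (cong part (outsideStart-unique p p-sp y∈p z∈p
                              (x~y ∘ trans x≈a ∘ sym) (x~z ∘ trans x≈a ∘ sym)))
  ... | no  x~a | yes y≈a = x~z (cong part (outsideStart-unique p p-sp x∈p z∈p
                              x~a (y~z ∘ trans y≈a ∘ sym)))
  ... | no  x~a | no  y~a = x~y (cong part (outsideStart-unique p p-sp x∈p y∈p x~a y~a))

  detour-isShortest : ∀ {u v w} → part u ≡ part v → u ≢ v → (u~w : u ~ w) (w~v : w ~ v) →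
                      IsShortestPath G (_∷_ {w = w} u~w (w~v ∷ []))
  detour-isShortest {u} {v} {w} u≈v u≢v u~w w~v = distinct , minimal
    where
    distinct : Unique (u ∷ w ∷ v ∷ [])
    distinct = ((u~w ∘ cong part) ∷ u≢v ∷ []) ∷ ((w~v ∘ cong part) ∷ []) ∷ [] ∷ []
    minimal : (q : Walk G u v) → 2 ≤ len G q
    minimal []          = ⊥-elim (u≢v refl)
    minimal (u~v ∷ [])  = ⊥-elim (u~v u≈v)
    minimal (_ ∷ _ ∷ _) = s≤s (s≤s z≤n)

  genPos-atMostOnePerPart : ∀ {T u v w} → IsGenPos G T → w ∈ T → u ∈ T → v ∈ T →
                            part u ≡ part v → part w ≢ part u → u ≡ v
  genPos-atMostOnePerPart {u = u} {v} {w} (_ , no-three) w∈T u∈T v∈T u≈v w~u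
    with ≡-dec _≟_ _≟_ u v
  ... | yes u≡v = u≡v
  ... | no  u≢v = ⊥-elim (no-three (_∷_ {w = w} u~w (w~v ∷ []))
                    (detour-isShortest u≈v u≢v u~w w~v) u w v u∈T w∈T v∈T
                    (u~w ∘ cong part) u≢v (w~v ∘ cong part)
                    (here refl , there (here refl) , there (there (here refl))))
    where
    u~w : u ~ w
    u~w = w~u ∘ sym
    w~v : w ~ v
    w~v w≈v = w~u (trans w≈v (sym u≈v))

  transversal : ((i : Fin r) → Fin (n i)) → List V
  transversal σ = tabulate λ i → i , σ i

  module _ (σ : (i : Fin r) → Fin (n i)) where

    transversal-unique : Unique (transversal σ)
    transversal-unique = tabulate⁺ (cong part)

    ∈-transversal : ∀ i → (i , σ i) ∈ transversal σ
    ∈-transversal = ∈-tabulate⁺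

    transversal-partInjective : ∀ {x y} → x ∈ transversal σ → y ∈ transversal σ →
                                part x ≡ part y → x ≡ y
    transversal-partInjective x∈ y∈ x≈y with ∈-tabulate⁻ x∈ | ∈-tabulate⁻ y∈
    ... | _ , refl | _ , refl = cong (λ i → i , σ i) x≈y

    transversal-isGenPos : IsGenPos G (transversal σ)
    transversal-isGenPos = transversal-unique ,
      λ p p-sp x y z x∈ y∈ z∈ x≢y x≢z y≢z (x∈p , y∈p , z∈p) →
        shortest-meetsAtMostTwoParts p p-sp x∈p y∈p z∈p
          (x≢y ∘ transversal-partInjective x∈ y∈) (x≢z ∘ transversal-partInjective x∈ z∈)
          (y≢z ∘ transversal-partInjective y∈ z∈)

    transversal-isMaximal : 2 ≤ r → ∀ T → IsGenPos G T →
                            (G ⊆ₗ transversal σ) T → (G ⊆ₗ T) (transversal σ)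
    transversal-isMaximal 2≤r T T-gp σ⊆T {j , a} ja∈T
      with genPos-atMostOnePerPart T-gp (σ⊆T (∈-transversal (proj₁ (anotherPart 2≤r j)))) ja∈T
             (σ⊆T (∈-transversal j)) refl (proj₂ (anotherPart 2≤r j))
    ... | refl = ∈-transversal j

    transversal-isTerminal : 2 ≤ r → IsTerminal G (transversal σ)
    transversal-isTerminal 2≤r = (transversal-isGenPos , transversal-isMaximal 2≤r) ,
      λ { (j , a) ja∉σ →
        let k , k≢j = anotherPart 2≤r j
            ja≢jσ = λ ja≡jσ → ja∉σ (subst (_∈ transversal σ) (sym ja≡jσ) (∈-transversal j))
            ja~kσ = k≢j ∘ sym
            kσ~jσ = k≢j
        in (j , σ j) , inj₁ (_∷_ {w = k , σ k} ja~kσ (kσ~jσ ∷ []) ,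
             detour-isShortest refl ja≢jσ ja~kσ kσ~jσ ,
             (k , σ k) , (j , σ j) , ∈-transversal k , ∈-transversal j , k≢j ∘ cong part ,
             there (here refl) , there (there (here refl))) }

  terminal-meetsEveryPart : ∀ {S} → IsTerminal G S → (i : Fin r) → Fin (n i) → ∃ λ a → (i , a) ∈ S
  terminal-meetsEveryPart {S} (_ , reachesTwo) i a with any? (λ x → part x ≟ i) S
  ... | yes meets with find meets
  ...   | (_ , b) , b∈S , refl = b , b∈S
  terminal-meetsEveryPart {S} (_ , reachesTwo) i a | no misses
    with reachesTwo (i , a) (λ ia∈S → misses (lose ia∈S refl))
  ... | _ , inj₁ (p , p-sp , x , y , x∈S , y∈S , x≢y , x∈p , y∈p) =
    ⊥-elim (x≢y (outsideStart-unique p p-sp x∈p y∈p (misses ∘ lose x∈S) (misses ∘ lose y∈S)))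
  ... | _ , inj₂ (p , p-sp , x , y , x∈S , y∈S , x≢y , x∈p , y∈p) =
    ⊥-elim (x≢y (outsideEnd-unique p p-sp x∈p y∈p (misses ∘ lose x∈S) (misses ∘ lose y∈S)))

  terminal≈transversal : 2 ≤ r → ((i : Fin r) → Fin (n i)) → ∀ {S} → IsTerminal G S →
                     ∃ λ σ → S ∼[ set ] transversal σ
  terminal≈transversal 2≤r vertexOf {S} S-term@((S-gp , _) , _) = σ , mk⇔ S⊆σ σ⊆S
    where
    meets : (i : Fin r) → ∃ λ a → (i , a) ∈ S
    meets i = terminal-meetsEveryPart S-term i (vertexOf i)
    σ : (i : Fin r) → Fin (n i)
    σ i = proj₁ (meets i)
    σ⊆S : ∀ {x} → x ∈ transversal σ → x ∈ S
    σ⊆S x∈σ with ∈-tabulate⁻ x∈σ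
    ... | i , refl = proj₂ (meets i)
    S⊆σ : ∀ {x} → x ∈ S → x ∈ transversal σ
    S⊆σ {j , a} ja∈S
      with genPos-atMostOnePerPart S-gp (proj₂ (meets (proj₁ (anotherPart 2≤r j)))) ja∈S
             (proj₂ (meets j)) refl (proj₂ (anotherPart 2≤r j))
    ... | refl = ∈-transversal σ j

  terminal-length : 2 ≤ r → ((i : Fin r) → Fin (n i)) → ∀ {S} → IsTerminal G S → length S ≡ r
  terminal-length 2≤r vertexOf S-term@(((S-unique , _) , _) , _) =
    let σ , S≈σ = terminal≈transversal 2≤r vertexOf S-term
    in trans (unique∧set⇒length≡ S-unique (transversal-unique σ) S≈σ) (length-tabulate _)

terminal-constantOrder⇒tp≡tp⁻ : ∀ {G k} → (∃ λ S → IsTerminal G S) →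
                                 (∀ S → IsTerminal G S → length S ≡ k) → IsTp G k × IsTpMinus G k
terminal-constantOrder⇒tp≡tp⁻ (S , S-term) order≡k =
  ((S , S-term , order≡k S S-term) , λ T T-term → ≤-reflexive (order≡k T T-term)) ,
  ((S , S-term , order≡k S S-term) , λ T T-term → ≤-reflexive (sym (order≡k T T-term)))

theorem4p4 : (r : ℕ) → (n : Fin r → ℕ) → 2 ≤ r →
    (∀ (i j : Fin r) → Data.Fin._≤_ i j → n j ≤ n i) →
    (∀ (i : Fin r) → 2 ≤ n i) →
    IsTp (K r n) r × IsTpMinus (K r n) r
theorem4p4 r n 2≤r _ 2≤n =
  terminal-constantOrder⇒tp≡tp⁻ (transversal σ₀ , transversal-isTerminal σ₀ 2≤r)
    (λ _ → terminal-length 2≤r σ₀)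
  where
  σ₀ : (i : Fin r) → Fin (n i)
  σ₀ i = fromℕ< (2≤n i)
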